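{- Let $(\hat H,\hat s,\hat t)$ be a subcubic two-rooted tree such that (i) $\hat s\neq\hat t$ and $\hat t$ is adjacent to a leaf $\hat\ell$ of $\hat H$ distinct from $\hat s$, and (ii) $\hat s$ has no false twin in $\hat H$. Then $(\hat H,\hat s,\hat t)$ is non-inherent.
   Context: Graphs are finite, simple and undirected. Two vertices $u,v$ are false twins if they are non-adjacent and $N(u)=N(v)$. A two-rooted graph is a triple $(H,s,t)$ with $H$ a graph and $s,t\in V(H)$ not necessarily distinct, with convention $d_H(s)\le d_H(t)$. A subcubic two-rooted tree is a two-rooted graph $(H,s,t)$ such that either $H$ is a path having $s$ as an endpoint, or $H$ is a tree of maximum degree $3$ with $1=d_H(s)\le d_H(t)\le 2$, where $d_H(t)=1$ iff $s=t$. A copy of $(\hat H,\hat s,\hat t)$ in $G$ is $(H,s,t)$ with $H$ an induced subgraph of $G$ and an isomorphism $\hat H\to H$ mapping $\hat s\mapsto s$, $\hat t\mapsto t$. An extension of a copy $(H,s,t)$ in $G$ is $(H',s',t')$ with $H'$ an induced subgraph of $G$, $V(H')=V(H)\cup\{s',t'\}$, $s'\ne t'$ not in $V(H)$, $H'-\{s',t'\}=H$, and $s$ (resp. $t$) the unique neighbour of $s'$ (resp. $t'$) in $H'$; it is closable if there is an induced $s',t'$-path in $G$ all of whose internal vertices lie outside $N_G[V(H)]$. A copy is avoidable if all its extensions are closable. $(\hat H,\hat s,\hat t)$ is inherent if every graph containing an induced subgraph isomorphic to $\hat H$ contains an avoidable copy of $(\hat H,\hat s,\hat t)$. -}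

module Defs where

open import Data.Nat using (ℕ; zero; suc; _+_; _≤_; _<_)
open import Data.Fin using (Fin; zero; suc; toℕ; fromℕ; inject₁)
open import Data.Bool using (Bool; true; false; if_then_else_)
open import Data.Product using (Σ; ∃; ∃-syntax; _×_; _,_)
open import Data.Sum using (_⊎_)
open import Relation.Binary.PropositionalEquality using (_≡_; _≢_)
open import Relation.Nullary using (¬_)
open import Function.Bundles using (_⇔_)
open import Function.Definitions using (Injective; Surjective)

record Graph : Set where
  field
    order  : ℕ
    adj    : Fin order → Fin order → Bool
    adj-sym    : ∀ u v → adj u v ≡ adj v u
    adj-irrefl : ∀ v → adj v v ≡ false
open Graph public

V : Graph → Set
V G = Fin (order G)

E : (G : Graph) → V G → V G → Set
E G u v = adj G u v ≡ true

sumFin : ∀ {n} → (Fin n → ℕ) → ℕ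
sumFin {zero}  f = 0
sumFin {suc n} f = f zero + sumFin (λ i → f (suc i))

deg : (G : Graph) → V G → ℕ
deg G v = sumFin (λ u → if adj G v u then 1 else 0)

Consec : ∀ {k} → Fin k → Fin k → Set
Consec i j = (suc (toℕ i) ≡ toℕ j) ⊎ (suc (toℕ j) ≡ toℕ i)

record InducedPath (G : Graph) : Set where
  field
    len   : ℕ
    vert  : Fin (suc len) → V G
    inj   : Injective _≡_ _≡_ vert
    indAdj : ∀ i j → E G (vert i) (vert j) ⇔ Consec i j
open InducedPath public

first : ∀ {G} → (P : InducedPath G) → V G
first P = vert P zero

last : ∀ {G} → (P : InducedPath G) → V G
last P = vert P (fromℕ (len P))

Internal : ∀ {G} → (P : InducedPath G) → Fin (suc (len P)) → Set
Internal P i = (0 < toℕ i) × (toℕ i < len P)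

IsPathWithEnd : (H : Graph) → V H → Set
IsPathWithEnd H s = Σ (InducedPath H) λ P → Surjective _≡_ _≡_ (vert P) × first P ≡ s

data Reach (G : Graph) (u : V G) : V G → Set where
  here : Reach G u u
  step : ∀ {v w} → Reach G u v → E G v w → Reach G u w

Connected : Graph → Set
Connected G = ∀ u v → Reach G u v

record Cycle (G : Graph) : Set where
  field
    clen  : ℕ
    two≤  : 2 ≤ clen
    cvert : Fin (suc clen) → V G
    cinj  : Injective _≡_ _≡_ cvert
    cadj  : ∀ (i : Fin clen) → E G (cvert (inject₁ i)) (cvert (suc i))
    cclose : E G (cvert (fromℕ clen)) (cvert zero)

IsTree : Graph → Set
IsTree G = Connected G × ¬ Cycle G

MaxDeg≤ : Graph → ℕ → Set
MaxDeg≤ G d = ∀ v → deg G v ≤ d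

-- two-rooted graph convention d(s) ≤ d(t), plus the subcubic-tree condition
SubcubicTwoRootedTree : (H : Graph) → V H → V H → Set
SubcubicTwoRootedTree H s t =
  (deg H s ≤ deg H t) ×
  (IsPathWithEnd H s
   ⊎ (IsTree H × MaxDeg≤ H 3 × deg H s ≡ 1 × deg H s ≤ deg H t × deg H t ≤ 2
      × ((deg H t ≡ 1) ⇔ (s ≡ t))))

Leaf : (H : Graph) → V H → Set
Leaf H v = deg H v ≡ 1

FalseTwins : (H : Graph) → V H → V H → Set
FalseTwins H u v = u ≢ v × ¬ E H u v × (∀ w → adj H u w ≡ adj H v w)

record Embedding (Ĥ G : Graph) : Set where
  field
    map    : V Ĥ → V G
    minj   : Injective _≡_ _≡_ map
    preserve : ∀ i j → adj G (map i) (map j) ≡ adj Ĥ i j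
open Embedding public

module _ {Ĥ G : Graph} (f : Embedding Ĥ G) where
  InImage : V G → Set
  InImage v = ∃[ i ] map f i ≡ v

  InClosedNbhd : V G → Set
  InClosedNbhd v = InImage v ⊎ (∃[ i ] E G (map f i) v)

  IsExtension : (s t s' t' : V G) → Set
  IsExtension s t s' t' =
    s' ≢ t' × ¬ InImage s' × ¬ InImage t' ×
    E G s s' × (∀ i → E G (map f i) s' → map f i ≡ s) × ¬ E G s' t' ×
    E G t t' × (∀ i → E G (map f i) t' → map f i ≡ t)

  Closable : (s' t' : V G) → Set
  Closable s' t' = Σ (InducedPath G) λ P →
    first P ≡ s' × last P ≡ t' ×
    (∀ i → Internal P i → ¬ InClosedNbhd (vert P i))

  AvoidableCopy : (ŝ t̂ : V Ĥ) → Set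
  AvoidableCopy ŝ t̂ = ∀ s' t' → IsExtension (map f ŝ) (map f t̂) s' t' → Closable s' t'

Inherent : (Ĥ : Graph) → V Ĥ → V Ĥ → Set
Inherent Ĥ ŝ t̂ = ∀ (G : Graph) → Embedding Ĥ G →
  Σ (Embedding Ĥ G) λ f → AvoidableCopy f ŝ t̂

NonInherent : (Ĥ : Graph) → V Ĥ → V Ĥ → Set
NonInherent Ĥ ŝ t̂ = ¬ Inherent Ĥ ŝ t̂

module Submission where

-- Let n be the order of Ĥ. Attach to every vertex u of Ĥ its own cycle of length n + 3 (through u) and
-- then double every vertex into a pair of false twins. In this graph G every copy (H, s, t) has the
-- extension (s′, t′) where t′ is the twin of the copy of ℓ and s′ is a cycle-neighbour of s avoiding the
-- copy of the neighbour of ŝ. It is not closable, because the last internal vertex of a closing path is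
-- adjacent to t′, hence to the copy of ℓ. That it is an extension at all uses that ŝ and ℓ have no false
-- twins (the latter follows from the former since t̂ has at most two neighbours) and that the cycles are
-- long: were another vertex of the connected copy next to s′, the copy would have to occupy all n + 2
-- positions of the cycle other than s′.

open import Defs
open import Data.Nat using (ℕ; zero; suc; _+_; _*_; _≤_; _<_; s≤s; z≤n)
import Data.Nat.Properties as ℕP
open import Algebra.Properties.CommutativeSemigroup ℕP.+-commutativeSemigroup using (x∙yz≈y∙xz)
open import Data.Fin as F using (Fin; toℕ; fromℕ; fromℕ<; punchIn; punchOut; combine; remQuot)
import Data.Fin.Properties as FP
open import Data.Fin.Induction using (<-weakInduction)
open import Data.Bool using (true; false; if_then_else_)
import Data.Bool.Properties as BP
open import Data.Product using (Σ; Σ-syntax; ∃-syntax; ∃₂; _×_; _,_; proj₁; proj₂)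
import Data.Product.Properties as PP
open import Data.Sum as Sum using (_⊎_; inj₁; inj₂; [_,_]′; swap)
open import Data.Empty using (⊥; ⊥-elim)
open import Relation.Nullary using (¬_; Dec; yes; no; does)
open import Relation.Nullary.Decidable using (¬?; _⊎-dec_; _×-dec_; decidable-stable; dec-true; dec-false; does-⇔)
open import Relation.Unary using (Decidable)
open import Relation.Binary.Definitions using (tri<; tri≈; tri>)
open import Relation.Binary.PropositionalEquality
open import Function.Base using (_∘_)
open import Function.Bundles using (Equivalence; _⇔_; mk⇔)
open import Function.Definitions using (Surjective)

E-sym : ∀ G {u v} → E G u v → E G v u
E-sym G {u} {v} e = trans (adj-sym G v u) e

E-irrefl : ∀ G {u} → ¬ E G u u
E-irrefl G {u} e with () ← trans (sym e) (adj-irrefl G u)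

false-twins : ∀ G {u v} → u ≢ v → (∀ w → adj G u w ≡ adj G v w) → FalseTwins G u v
false-twins G {u} {v} u≢v same = u≢v , (λ e → E-irrefl G (trans (sym (same v)) e)) , same

Reach-trans : ∀ {G u v w} → Reach G u v → Reach G v w → Reach G u w
Reach-trans p here       = p
Reach-trans p (step q e) = step (Reach-trans p q) e

Reach-sym : ∀ {G u v} → Reach G u v → Reach G v u
Reach-sym here = here
Reach-sym {G} (step p e) = Reach-trans (step here (E-sym G e)) (Reach-sym p)

Reach-first-edge : ∀ {G u w} → Reach G u w → u ≢ w → ∃[ x ] E G u x
Reach-first-edge here u≢u = ⊥-elim (u≢u refl)
Reach-first-edge {G} {u} (step {v} p e) u≢w with u FP.≟ v
... | yes refl = _ , e
... | no u≢v   = Reach-first-edge p u≢v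

Reach-exit-edge : ∀ {G u w} {P : V G → Set} → Decidable P → Reach G u w → P u → ¬ P w →
  ∃₂ λ x y → E G x y × P x × ¬ P y
Reach-exit-edge P? here Pu ¬Pu = ⊥-elim (¬Pu Pu)
Reach-exit-edge P? (step {v} p e) Pu ¬Pw with P? v
... | yes Pv = _ , _ , e , Pv , ¬Pw
... | no ¬Pv = Reach-exit-edge P? p Pu ¬Pv

sumFin-punchIn : ∀ {n} (f : Fin (suc n) → ℕ) i → sumFin f ≡ f i + sumFin (f ∘ punchIn i)
sumFin-punchIn f F.zero = refl
sumFin-punchIn {suc n} f (F.suc i) = begin
  f F.zero + sumFin (f ∘ F.suc)                                 ≡⟨ cong (f F.zero +_) (sumFin-punchIn (f ∘ F.suc) i) ⟩
  f F.zero + (f (F.suc i) + sumFin (f ∘ F.suc ∘ punchIn i))     ≡⟨ x∙yz≈y∙xz (f F.zero) (f (F.suc i)) _ ⟩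
  f (F.suc i) + sumFin (f ∘ punchIn (F.suc i))                  ∎
  where open ≡-Reasoning

sumFin-≥-one : ∀ {n} (f : Fin n → ℕ) i → f i ≤ sumFin f
sumFin-≥-one f F.zero    = ℕP.m≤m+n _ _
sumFin-≥-one f (F.suc i) = ℕP.≤-trans (sumFin-≥-one (f ∘ F.suc) i) (ℕP.m≤n+m _ _)

sumFin-≥-two : ∀ {n} (f : Fin n → ℕ) {i j} → i ≢ j → f i + f j ≤ sumFin f
sumFin-≥-two {suc n} f {i} {j} i≢j = begin
  f i + f j                                      ≡⟨ cong (λ x → f i + f x) (sym (FP.punchIn-punchOut i≢j)) ⟩
  f i + f (punchIn i (punchOut i≢j))             ≤⟨ ℕP.+-monoʳ-≤ (f i) (sumFin-≥-one (f ∘ punchIn i) _) ⟩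
  f i + sumFin (f ∘ punchIn i)                   ≡⟨ sym (sumFin-punchIn f i) ⟩
  sumFin f                                       ∎
  where open ℕP.≤-Reasoning

sumFin-≥-three : ∀ {n} (f : Fin n → ℕ) {i j k} → i ≢ j → i ≢ k → j ≢ k → f i + (f j + f k) ≤ sumFin f
sumFin-≥-three {suc n} f {i} {j} {k} i≢j i≢k j≢k = begin
  f i + (f j + f k)
      ≡⟨ cong₂ (λ x y → f i + (f x + f y)) (sym (FP.punchIn-punchOut i≢j)) (sym (FP.punchIn-punchOut i≢k)) ⟩
  f i + (f (punchIn i (punchOut i≢j)) + f (punchIn i (punchOut i≢k)))
      ≤⟨ ℕP.+-monoʳ-≤ (f i) (sumFin-≥-two (f ∘ punchIn i) (j≢k ∘ FP.punchOut-injective i≢j i≢k)) ⟩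
  f i + sumFin (f ∘ punchIn i)                               ≡⟨ sym (sumFin-punchIn f i) ⟩
  sumFin f                                                   ∎
  where open ℕP.≤-Reasoning

AtMostOneNeighbour : (G : Graph) → V G → Set
AtMostOneNeighbour G v = ∀ {a b} → E G v a → E G v b → a ≡ b

ThreeNeighbours : (G : Graph) → V G → Set
ThreeNeighbours G v = ∃[ a ] ∃[ b ] ∃[ c ] (a ≢ b × a ≢ c × b ≢ c × E G v a × E G v b × E G v c)

neighbour-counts-one : ∀ G {v a} → E G v a → (if adj G v a then 1 else 0) ≡ 1
neighbour-counts-one G e = cong (λ b → if b then 1 else 0) e

deg-≥-two : ∀ G {v a b} → a ≢ b → E G v a → E G v b → 2 ≤ deg G v
deg-≥-two G {v} a≢b ea eb = subst (_≤ deg G v)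
  (cong₂ _+_ (neighbour-counts-one G ea) (neighbour-counts-one G eb)) (sumFin-≥-two _ a≢b)

deg-≥-three : ∀ G {v} → ThreeNeighbours G v → 3 ≤ deg G v
deg-≥-three G {v} (a , b , c , a≢b , a≢c , b≢c , ea , eb , ec) = subst (_≤ deg G v)
  (cong₂ _+_ (neighbour-counts-one G ea) (cong₂ _+_ (neighbour-counts-one G eb) (neighbour-counts-one G ec)))
  (sumFin-≥-three _ a≢b a≢c b≢c)

deg≡1⇒atMostOneNeighbour : ∀ G {v} → deg G v ≡ 1 → AtMostOneNeighbour G v
deg≡1⇒atMostOneNeighbour G {v} d≡1 {a} {b} ea eb with a FP.≟ b
... | yes a≡b = a≡b
... | no a≢b with s≤s () ← subst (2 ≤_) d≡1 (deg-≥-two G a≢b ea eb)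

deg≤2⇒¬threeNeighbours : ∀ G {v} → deg G v ≤ 2 → ¬ ThreeNeighbours G v
deg≤2⇒¬threeNeighbours G d≤2 three with s≤s (s≤s ()) ← ℕP.≤-trans (deg-≥-three G three) d≤2

Consec-above-unique : ∀ {k} {a c c′ : Fin k} → suc (toℕ a) ≡ toℕ c → suc (toℕ a) ≡ toℕ c′ → c ≡ c′
Consec-above-unique e e′ = FP.toℕ-injective (trans (sym e) e′)

Consec-below-unique : ∀ {k} {a c c′ : Fin k} → suc (toℕ c) ≡ toℕ a → suc (toℕ c′) ≡ toℕ a → c ≡ c′
Consec-below-unique e e′ = FP.toℕ-injective (ℕP.suc-injective (trans e (sym e′)))

Consec-at-most-two : ∀ {k} {a c₁ c₂ c₃ : Fin k} → Consec a c₁ → Consec a c₂ → Consec a c₃ →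
  c₁ ≡ c₂ ⊎ c₁ ≡ c₃ ⊎ c₂ ≡ c₃
Consec-at-most-two (inj₁ x) (inj₁ y) _        = inj₁ (Consec-above-unique x y)
Consec-at-most-two (inj₂ x) (inj₂ y) _        = inj₁ (Consec-below-unique x y)
Consec-at-most-two (inj₁ x) (inj₂ _) (inj₁ z) = inj₂ (inj₁ (Consec-above-unique x z))
Consec-at-most-two (inj₁ _) (inj₂ y) (inj₂ z) = inj₂ (inj₂ (Consec-below-unique y z))
Consec-at-most-two (inj₂ x) (inj₁ _) (inj₂ z) = inj₂ (inj₁ (Consec-below-unique x z))
Consec-at-most-two (inj₂ _) (inj₁ y) (inj₁ z) = inj₂ (inj₂ (Consec-above-unique y z))

Consec-zero : ∀ {k} {c : Fin (suc k)} → Consec F.zero c → toℕ c ≡ 1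
Consec-zero (inj₁ e) = sym e

module SpanningPath {H : Graph} (P : InducedPath H) (onto : Surjective _≡_ _≡_ (vert P)) where

  private
    preimage : ∀ v → ∃[ a ] vert P a ≡ v
    preimage v = proj₁ (onto v) , proj₂ (onto v) refl

    E⇒Consec : ∀ {a c} → E H (vert P a) (vert P c) → Consec a c
    E⇒Consec = Equivalence.to (indAdj P _ _)

  Reach-from-first : ∀ a → Reach H (first P) (vert P a)
  Reach-from-first = <-weakInduction (Reach H (first P) ∘ vert P) here
    λ a r → step r (Equivalence.from (indAdj P _ _) (inj₁ (cong suc (FP.toℕ-inject₁ a))))

  connected : Connected H
  connected u v with preimage u | preimage v
  ... | a , refl | c , refl = Reach-trans (Reach-sym (Reach-from-first a)) (Reach-from-first c)

  first-atMostOneNeighbour : AtMostOneNeighbour H (first P)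
  first-atMostOneNeighbour {x} {y} ex ey with preimage x | preimage y
  ... | a , refl | c , refl =
    cong (vert P) (FP.toℕ-injective (trans (Consec-zero (E⇒Consec ex)) (sym (Consec-zero (E⇒Consec ey)))))

  ¬threeNeighbours : ∀ v → ¬ ThreeNeighbours H v
  ¬threeNeighbours v (x , y , z , x≢y , x≢z , y≢z , ex , ey , ez)
    with preimage v | preimage x | preimage y | preimage z
  ... | _ , refl | _ , refl | _ , refl | _ , refl =
    [ x≢y ∘ cong (vert P) , [ x≢z ∘ cong (vert P) , y≢z ∘ cong (vert P) ]′ ]′
      (Consec-at-most-two (E⇒Consec ex) (E⇒Consec ey) (E⇒Consec ez))

module SubcubicTwoRootedTree-properties {H s t} (tree : SubcubicTwoRootedTree H s t) where

  connected : Connected H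
  connected with proj₂ tree
  ... | inj₁ (P , onto , _)  = SpanningPath.connected P onto
  ... | inj₂ ((conn , _) , _) = conn

  s-atMostOneNeighbour : AtMostOneNeighbour H s
  s-atMostOneNeighbour with proj₂ tree
  ... | inj₁ (P , onto , refl)      = SpanningPath.first-atMostOneNeighbour P onto
  ... | inj₂ (_ , _ , deg-s≡1 , _) = deg≡1⇒atMostOneNeighbour H deg-s≡1

  t-¬threeNeighbours : ¬ ThreeNeighbours H t
  t-¬threeNeighbours with proj₂ tree
  ... | inj₁ (P , onto , _)              = SpanningPath.¬threeNeighbours P onto t
  ... | inj₂ (_ , _ , _ , _ , deg-t≤2 , _) = deg≤2⇒¬threeNeighbours H deg-t≤2

NoFalseTwin : (G : Graph) → V G → Set
NoFalseTwin G u = ¬ (∃[ v ] FalseTwins G u v)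

-- A false twin m ≠ s of ℓ is a second leaf at t; a walk from s to t enters {t, ℓ, m} through t,
-- which gives t a third neighbour.
leaf-noFalseTwin : ∀ {H s t ℓ} → Connected H → ¬ ThreeNeighbours H t → AtMostOneNeighbour H ℓ → E H t ℓ →
  s ≢ t → ℓ ≢ s → NoFalseTwin H s → NoFalseTwin H ℓ
leaf-noFalseTwin {H} {s} {t} {ℓ} conn t-three ℓ-one t∼ℓ s≢t ℓ≢s s-twinless (m , ℓ≢m , ℓ≁m , same)
  with m FP.≟ s
... | yes refl = s-twinless (ℓ , ℓ≢s ∘ sym , ℓ≁m ∘ E-sym H , sym ∘ same)
... | no m≢s   = t-three third-neighbour
  where
  Near : V H → Set
  Near w = w ≡ t ⊎ w ≡ ℓ ⊎ w ≡ m

  Near? : ∀ w → Dec (Near w)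
  Near? w = (w FP.≟ t) ⊎-dec (w FP.≟ ℓ) ⊎-dec (w FP.≟ m)

  only-t-next-to-ℓ : ∀ {w} → E H ℓ w → w ≡ t
  only-t-next-to-ℓ ℓ∼w = ℓ-one ℓ∼w (E-sym H t∼ℓ)

  t∼m : E H t m
  t∼m = E-sym H (trans (sym (same t)) (E-sym H t∼ℓ))

  entry-from-t : ∀ {r y} → E H r y → ¬ Near r → ¬ ¬ Near y → E H t r
  entry-from-t {y = y} r∼y r-far y-near with decidable-stable (Near? y) y-near
  ... | inj₁ refl        = E-sym H r∼y
  ... | inj₂ (inj₁ refl) = ⊥-elim (r-far (inj₁ (only-t-next-to-ℓ (E-sym H r∼y))))
  ... | inj₂ (inj₂ refl) = ⊥-elim (r-far (inj₁ (only-t-next-to-ℓ (trans (same _) (E-sym H r∼y)))))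

  third-neighbour : ThreeNeighbours H t
  third-neighbour
    with Reach-exit-edge (¬? ∘ Near?) (conn s t) [ s≢t , [ ℓ≢s ∘ sym , m≢s ∘ sym ]′ ]′ (λ far → far (inj₁ refl))
  ... | r , _ , r∼y , r-far , y-near = ℓ , m , r , ℓ≢m , r-far ∘ inj₂ ∘ inj₁ ∘ sym , r-far ∘ inj₂ ∘ inj₂ ∘ sym
                                     , t∼ℓ , t∼m , entry-from-t r∼y r-far y-near

InducedPath-end : ∀ {G} (P : InducedPath G) →
  first P ≡ last P ⊎ E G (first P) (last P) ⊎ ∃[ i ] (Internal P i × E G (vert P i) (last P))
InducedPath-end record { len = zero } = inj₁ refl
InducedPath-end record { len = suc zero ; indAdj = indAdj } =
  inj₂ (inj₁ (Equivalence.from (indAdj F.zero (F.suc F.zero)) (inj₁ refl)))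
InducedPath-end record { len = suc (suc L) ; indAdj = indAdj } =
  inj₂ (inj₂ (penultimate , (0<penultimate , penultimate<len) , Equivalence.from (indAdj _ _) penultimate-consec))
  where
  penultimate : Fin (3 + L)
  penultimate = F.inject₁ (fromℕ (suc L))

  toℕ-penultimate : toℕ penultimate ≡ suc L
  toℕ-penultimate = trans (FP.toℕ-inject₁ (fromℕ (suc L))) (FP.toℕ-fromℕ (suc L))

  0<penultimate : 0 < toℕ penultimate
  0<penultimate = subst (0 <_) (sym toℕ-penultimate) (s≤s z≤n)

  penultimate<len : toℕ penultimate < suc (suc L)
  penultimate<len = subst (_< suc (suc L)) (sym toℕ-penultimate) (ℕP.n<1+n _)

  penultimate-consec : Consec penultimate (fromℕ (suc (suc L)))
  penultimate-consec = inj₁ (trans (cong suc toℕ-penultimate) (sym (FP.toℕ-fromℕ _)))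

covered-end⇒¬Closable : ∀ {Ĥ G} (f : Embedding Ĥ G) {s′ t′} → s′ ≢ t′ → ¬ E G s′ t′ →
  (∀ x → E G x t′ → InClosedNbhd f x) → ¬ Closable f s′ t′
covered-end⇒¬Closable f s′≢t′ s′≁t′ covered (P , refl , refl , avoids) with InducedPath-end P
... | inj₁ s′≡t′              = s′≢t′ s′≡t′
... | inj₂ (inj₁ s′∼t′)       = s′≁t′ s′∼t′
... | inj₂ (inj₂ (i , int , e)) = avoids i int (covered _ e)

_∘ᴱ_ : ∀ {H G K} → Embedding G K → Embedding H G → Embedding H K
g ∘ᴱ f = record
  { map      = map g ∘ map f
  ; minj     = minj f ∘ minj g
  ; preserve = λ i j → trans (preserve g _ _) (preserve f i j)
  }

cannot-cover : ∀ {n M} → n < M → (j : Fin (suc M)) (h : Fin n → Fin (suc M)) →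
  ¬ (∀ p → p ≢ j → ∃[ i ] h i ≡ p)
cannot-cover n<M j h covers =
  let q₁ , q₂ , q₁<q₂ , gq₁≡gq₂ = FP.pigeonhole n<M g
  in ℕP.<-irrefl (cong toℕ (FP.punchIn-injective j q₁ q₂ (trans (sym (hit q₁)) (trans (cong h gq₁≡gq₂) (hit q₂)))))
                 q₁<q₂
  where
  g : Fin _ → Fin _
  g q = proj₁ (covers (punchIn j q) (FP.punchInᵢ≢i j q))

  hit : ∀ q → h (g q) ≡ punchIn j q
  hit q = proj₂ (covers (punchIn j q) (FP.punchInᵢ≢i j q))

module CyclePositions (m : ℕ) where

  M : ℕ
  M = 3 + m

  Succ : ℕ → ℕ → Set
  Succ a b = suc a ≡ b ⊎ (b ≡ 0 × suc a ≡ M)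

  _∼_ : ℕ → ℕ → Set
  a ∼ b = Succ a b ⊎ Succ b a

  Succ? : ∀ a b → Dec (Succ a b)
  Succ? a b = (suc a ℕP.≟ b) ⊎-dec ((b ℕP.≟ 0) ×-dec (suc a ℕP.≟ M))

  _∼?_ : ∀ a b → Dec (a ∼ b)
  a ∼? b = Succ? a b ⊎-dec Succ? b a

  ∼-sym : ∀ {a b} → a ∼ b → b ∼ a
  ∼-sym = swap

  Succ-irrefl : ∀ {a} → ¬ Succ a a
  Succ-irrefl (inj₁ e)        = ℕP.1+n≢n e
  Succ-irrefl (inj₂ (refl , ()))

  ∼-irrefl : ∀ {a} → ¬ a ∼ a
  ∼-irrefl = [ Succ-irrefl , Succ-irrefl ]′

  Succ-asym : ∀ {a b} → Succ a b → ¬ Succ b a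
  Succ-asym {a} (inj₁ refl) (inj₁ e) = ℕP.<-irrefl (sym e) (ℕP.<-trans (ℕP.n<1+n a) (ℕP.n<1+n (suc a)))
  Succ-asym (inj₁ refl) (inj₂ (refl , ()))
  Succ-asym (inj₂ (refl , ())) (inj₁ refl)
  Succ-asym (inj₂ (refl , _)) (inj₂ (refl , ()))

  Succ-functional : ∀ {a b b′} → b < M → b′ < M → Succ a b → Succ a b′ → b ≡ b′
  Succ-functional _   _    (inj₁ e)       (inj₁ e′)       = trans (sym e) e′
  Succ-functional b<M _    (inj₁ e)       (inj₂ (_ , e′)) = ⊥-elim (ℕP.<-irrefl (trans (sym e) e′) b<M)
  Succ-functional _   b′<M (inj₂ (_ , e)) (inj₁ e′)       = ⊥-elim (ℕP.<-irrefl (trans (sym e′) e) b′<M)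
  Succ-functional _   _    (inj₂ (b≡0 , _)) (inj₂ (b′≡0 , _)) = trans b≡0 (sym b′≡0)

  Succ-injective : ∀ {a a′ b} → Succ a b → Succ a′ b → a ≡ a′
  Succ-injective (inj₁ e)          (inj₁ e′)         = ℕP.suc-injective (trans e (sym e′))
  Succ-injective (inj₁ refl)       (inj₂ (() , _))
  Succ-injective (inj₂ (refl , _)) (inj₁ ())
  Succ-injective (inj₂ (_ , e))    (inj₂ (_ , e′))   = ℕP.suc-injective (trans e (sym e′))

  successor : (x : Fin M) → Σ[ y ∈ Fin M ] Succ (toℕ x) (toℕ y)
  successor x with suc (toℕ x) ℕP.<? M
  ... | yes x+1<M = fromℕ< x+1<M , inj₁ (sym (FP.toℕ-fromℕ< x+1<M))
  ... | no  x+1≮M = F.zero , inj₂ (refl , ℕP.≤-antisym (FP.toℕ<n x) (ℕP.≮⇒≥ x+1≮M))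

  predecessor : (x : Fin M) → Σ[ y ∈ Fin M ] Succ (toℕ y) (toℕ x)
  predecessor F.zero    = fromℕ (2 + m) , inj₂ (refl , cong suc (FP.toℕ-fromℕ (2 + m)))
  predecessor (F.suc x) = F.inject₁ x , inj₁ (cong suc (FP.toℕ-inject₁ x))

  neighbour-avoiding : (x z : Fin M) → Σ[ y ∈ Fin M ] (toℕ x ∼ toℕ y × y ≢ z)
  neighbour-avoiding x z with successor x | predecessor x
  ... | y , x→y | y′ , y′→x with y FP.≟ z
  ...   | no y≢z   = y , inj₁ x→y , y≢z
  ...   | yes refl = y′ , inj₂ y′→x , λ { refl → Succ-asym x→y y′→x }

  neighbours-split : ∀ {j k k′} → k < M → k′ < M → k ≢ k′ → k ∼ j → k′ ∼ j →
    (Succ k j × Succ j k′) ⊎ (Succ j k × Succ k′ j)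
  neighbours-split _   _    k≢k′ (inj₁ k→j) (inj₁ k′→j) = ⊥-elim (k≢k′ (Succ-injective k→j k′→j))
  neighbours-split _   _    _    (inj₁ k→j) (inj₂ j→k′) = inj₁ (k→j , j→k′)
  neighbours-split _   _    _    (inj₂ j→k) (inj₁ k′→j) = inj₂ (j→k , k′→j)
  neighbours-split k<M k′<M k≢k′ (inj₂ j→k) (inj₂ j→k′) = ⊥-elim (k≢k′ (Succ-functional k<M k′<M j→k j→k′))

  Between : ℕ → ℕ → ℕ → Set
  Between lo hi x = lo < x × x < hi

  Between? : ∀ lo hi x → Dec (Between lo hi x)
  Between? lo hi x = (lo ℕP.<? x) ×-dec (x ℕP.<? hi)

  Between-exit : ∀ {lo hi a b} → hi < M → a ∼ b → Between lo hi a → ¬ Between lo hi b → b ≡ lo ⊎ b ≡ hi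
  Between-exit _ (inj₁ (inj₁ refl)) (lo<a , a<hi) b∉ =
    inj₂ (ℕP.≤-antisym a<hi (ℕP.≮⇒≥ λ b<hi → b∉ (ℕP.<-trans lo<a (ℕP.n<1+n _) , b<hi)))
  Between-exit {hi = hi} hi<M (inj₁ (inj₂ (_ , a+1≡M))) (_ , a<hi) _ = ⊥-elim (ℕP.<⇒≱ hi<M (subst (_≤ hi) a+1≡M a<hi))
  Between-exit _ (inj₂ (inj₁ refl)) (lo<a , a<hi) b∉ =
    inj₁ (ℕP.≤-antisym (ℕP.≮⇒≥ λ lo<b → b∉ (lo<b , ℕP.<-trans (ℕP.n<1+n _) a<hi)) (ℕP.m<1+n⇒m≤n lo<a))
  Between-exit _ (inj₂ (inj₂ (refl , _))) (lo<0 , _) _ = ⊥-elim (ℕP.n≮0 lo<0)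

  Fenced : (ℕ → Set) → ℕ → ℕ → Set
  Fenced A j p = ∀ {a b} → a ∼ b → A a → ¬ A b → b ≡ j ⊎ b ≡ p

  Separates : (ℕ → Set) → ℕ → ℕ → Set
  Separates A x y = (A x × ¬ A y) ⊎ (¬ A x × A y)

  Succ⇒Between-above : ∀ {j p k} → p < M → p ≢ k → j < p → Succ j k → Between j p k
  Succ⇒Between-above _   p≢k j<p (inj₁ refl)         = ℕP.n<1+n _ , ℕP.≤∧≢⇒< j<p (p≢k ∘ sym)
  Succ⇒Between-above {p = p} p<M _ j<p (inj₂ (_ , j+1≡M)) = ⊥-elim (ℕP.<⇒≱ p<M (subst (_≤ p) j+1≡M j<p))

  Succ⇒¬Between-above : ∀ {j p k} → p < M → Succ k j → ¬ Between j p k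
  Succ⇒¬Between-above _   (inj₁ refl)           (j<k , _)  = ℕP.<-asym (ℕP.n<1+n _) j<k
  Succ⇒¬Between-above {p = p} p<M (inj₂ (refl , k+1≡M)) (_ , k<p) = ℕP.<⇒≱ p<M (subst (_≤ p) k+1≡M k<p)

  Succ⇒Between-below : ∀ {j p k} → p ≢ k → p < j → Succ k j → Between p j k
  Succ⇒Between-below p≢k p<j (inj₁ refl) = ℕP.≤∧≢⇒< (ℕP.m<1+n⇒m≤n p<j) p≢k , ℕP.n<1+n _
  Succ⇒Between-below _   p<0 (inj₂ (refl , _)) = ⊥-elim (ℕP.n≮0 p<0)

  Succ⇒¬Between-below : ∀ {j p k} → Succ j k → ¬ Between p j k
  Succ⇒¬Between-below (inj₁ refl)       (_ , k<j)  = ℕP.<-asym (ℕP.n<1+n _) k<j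
  Succ⇒¬Between-below (inj₂ (refl , _)) (p<0 , _) = ℕP.n≮0 p<0

  -- Deleting positions j and p cuts the cycle into two arcs; the one avoiding 0 separates the neighbours of j.
  arc-separating-neighbours : ∀ {j p k k′} → j < M → p < M → k < M → k′ < M →
    p ≢ j → p ≢ k → p ≢ k′ → k ≢ k′ → k ∼ j → k′ ∼ j →
    Σ (ℕ → Set) λ A → Decidable A × ¬ A 0 × Fenced A j p × Separates A k k′
  arc-separating-neighbours {j} {p} j<M p<M k<M k′<M p≢j p≢k p≢k′ k≢k′ k∼j k′∼j
    with ℕP.<-cmp j p | neighbours-split k<M k′<M k≢k′ k∼j k′∼j
  ... | tri≈ _ j≡p _ | _ = ⊥-elim (p≢j (sym j≡p))
  ... | tri< j<p _ _ | split = Between j p , Between? j p , ℕP.n≮0 ∘ proj₁ , Between-exit p<M , separated split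
    where
    separated : (Succ _ j × Succ j _) ⊎ (Succ j _ × Succ _ j) → Separates (Between j p) _ _
    separated (inj₁ (k→j , j→k′)) = inj₂ (Succ⇒¬Between-above p<M k→j , Succ⇒Between-above p<M p≢k′ j<p j→k′)
    separated (inj₂ (j→k , k′→j)) = inj₁ (Succ⇒Between-above p<M p≢k j<p j→k , Succ⇒¬Between-above p<M k′→j)
  ... | tri> _ _ p<j | split = Between p j , Between? p j , ℕP.n≮0 ∘ proj₁
                              , (λ a∼b a∈ b∉ → swap (Between-exit j<M a∼b a∈ b∉)) , separated split
    where
    separated : (Succ _ j × Succ j _) ⊎ (Succ j _ × Succ _ j) → Separates (Between p j) _ _
    separated (inj₁ (k→j , j→k′)) = inj₁ (Succ⇒Between-below p≢k p<j k→j , Succ⇒¬Between-below j→k′)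
    separated (inj₂ (j→k , k′→j)) = inj₂ (Succ⇒¬Between-below j→k , Succ⇒Between-below p≢k′ p<j k′→j)

from-does : ∀ {A : Set} (a? : Dec A) → does a? ≡ true → A
from-does (yes a) _ = a

does-≟-true : ∀ b → does (b BP.≟ true) ≡ b
does-≟-true true  = refl
does-≟-true false = refl

module Doubling (G : Graph) where

  class : Fin (order G * 2) → V G
  class p = proj₁ (remQuot {order G} 2 p)

  class-combine : ∀ x b → class (combine x b) ≡ x
  class-combine x b = cong proj₁ (FP.remQuot-combine x b)

  double : Graph
  double = record
    { order      = order G * 2
    ; adj        = λ p q → adj G (class p) (class q)
    ; adj-sym    = λ p q → adj-sym G (class p) (class q)
    ; adj-irrefl = λ p → adj-irrefl G (class p)
    }

  twin : V double → V double
  twin p = combine (class p) (F.opposite (proj₂ (remQuot {order G} 2 p)))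

  twin-≢ : ∀ p → twin p ≢ p
  twin-≢ p twin≡p = opposite-≢ bit (FP.combine-injectiveʳ (class p) (F.opposite bit) (class p) bit
                                      (trans twin≡p (sym (FP.combine-remQuot {order G} 2 p))))
    where
    bit : Fin 2
    bit = proj₂ (remQuot {order G} 2 p)

    opposite-≢ : ∀ (b : Fin 2) → F.opposite b ≢ b
    opposite-≢ F.zero ()
    opposite-≢ (F.suc F.zero) ()

  class-twin : ∀ p → class (twin p) ≡ class p
  class-twin p = class-combine (class p) _

  adj-twin : ∀ p q → adj double p (twin q) ≡ adj double p q
  adj-twin p q = cong (adj G (class p)) (class-twin q)

  embedding : Embedding G double
  embedding = record
    { map      = λ x → combine x F.zero
    ; minj     = λ {x} {y} eq → trans (sym (class-combine x F.zero)) (trans (cong class eq) (class-combine y F.zero))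
    ; preserve = λ x y → cong₂ (adj G) (class-combine x F.zero) (class-combine y F.zero)
    }

module PendantCycles (H : Graph) where
  open CyclePositions (order H) public

  -- (u , x) is position x on the cycle attached to u; position zero is u itself.
  Site : Set
  Site = V H × Fin M

  _~_ : Site → Site → Set
  (u , x) ~ (u′ , x′) = (x ≡ F.zero × x′ ≡ F.zero × E H u u′) ⊎ (u ≡ u′ × toℕ x ∼ toℕ x′)

  _~?_ : ∀ p q → Dec (p ~ q)
  (u , x) ~? (u′ , x′) =
    ((x FP.≟ F.zero) ×-dec (x′ FP.≟ F.zero) ×-dec (adj H u u′ BP.≟ true))
    ⊎-dec ((u FP.≟ u′) ×-dec (toℕ x ∼? toℕ x′))

  ~-sym : ∀ {p q} → p ~ q → q ~ p
  ~-sym (inj₁ (x≡0 , x′≡0 , e)) = inj₁ (x′≡0 , x≡0 , E-sym H e)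
  ~-sym (inj₂ (refl , x∼x′))   = inj₂ (refl , ∼-sym x∼x′)

  ~-irrefl : ∀ {p} → ¬ p ~ p
  ~-irrefl (inj₁ (_ , _ , e)) = E-irrefl H e
  ~-irrefl (inj₂ (_ , x∼x))   = ∼-irrefl x∼x

  _≟ˢ_ : (p q : Site) → Dec (p ≡ q)
  _≟ˢ_ = PP.≡-dec FP._≟_ FP._≟_

  site : Fin (order H * M) → Site
  site = remQuot {order H} M

  graph : Graph
  graph = record
    { order      = order H * M
    ; adj        = λ p q → does (site p ~? site q)
    ; adj-sym    = λ p q → does-⇔ (mk⇔ ~-sym ~-sym) (site p ~? site q) (site q ~? site p)
    ; adj-irrefl = λ p → dec-false (site p ~? site p) ~-irrefl
    }

  hub-~⇔E : ∀ u u′ → (u , F.zero) ~ (u′ , F.zero) ⇔ E H u u′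
  hub-~⇔E u u′ = mk⇔ (λ { (inj₁ (_ , _ , e)) → e ; (inj₂ (_ , 0∼0)) → ⊥-elim (∼-irrefl 0∼0) })
                     (λ e → inj₁ (refl , refl , e))

  hub-embedding : Embedding H graph
  hub-embedding = record
    { map      = hub
    ; minj     = λ {u} {u′} eq → cong proj₁ (trans (sym (site-hub u)) (trans (cong site eq) (site-hub u′)))
    ; preserve = λ u u′ → trans (cong₂ (λ p q → does (p ~? q)) (site-hub u) (site-hub u′))
                                (trans (does-⇔ (hub-~⇔E u u′) ((u , F.zero) ~? (u′ , F.zero)) (adj H u u′ BP.≟ true))
                                       (does-≟-true _))
    }
    where
    hub : V H → V graph
    hub u = combine u F.zero

    site-hub : ∀ u → site (hub u) ≡ (u , F.zero)
    site-hub u = FP.remQuot-combine u F.zero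

module Obstruction (H : Graph) where
  open PendantCycles H public
  open Doubling graph public

  siteOf : V double → Site
  siteOf x = site (class x)

  vertexAt : Site → V double
  vertexAt (u , x) = combine (combine u x) F.zero

  siteOf-vertexAt : ∀ w → siteOf (vertexAt w) ≡ w
  siteOf-vertexAt (u , x) = trans (cong site (class-combine (combine u x) F.zero)) (FP.remQuot-combine u x)

  copy : Embedding H double
  copy = embedding ∘ᴱ hub-embedding

  module _ {s t ℓ : V H} (conn : Connected H) (s≢t : s ≢ t) (s-one : AtMostOneNeighbour H s)
           (s-twinless : NoFalseTwin H s) (ℓ-one : AtMostOneNeighbour H ℓ) (t∼ℓ : E H t ℓ) (ℓ≢s : ℓ ≢ s)
           (ℓ-twinless : NoFalseTwin H ℓ) (f : Embedding H double) where

    C : V H → Site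
    C i = siteOf (map f i)

    E⇒~ : ∀ {i j} → E H i j → C i ~ C j
    E⇒~ {i} {j} e = from-does (C i ~? C j) (trans (preserve f i j) e)

    ~⇒E : ∀ {i j} → C i ~ C j → E H i j
    ~⇒E {i} {j} a = trans (sym (preserve f i j)) (dec-true (C i ~? C j) a)

    same-site⇒same-adj : ∀ {i i′} → C i ≡ C i′ → ∀ w → adj H i w ≡ adj H i′ w
    same-site⇒same-adj {i} {i′} eq w =
      trans (sym (preserve f i w)) (trans (cong (λ z → does (z ~? C w)) eq) (preserve f i′ w))

    same-site⇒≡ : ∀ {u i} → NoFalseTwin H u → C i ≡ C u → i ≡ u
    same-site⇒≡ {u} {i} twinless eq with i FP.≟ u
    ... | yes i≡u = i≡u
    ... | no  i≢u = ⊥-elim (twinless (i , false-twins H (i≢u ∘ sym) (same-site⇒same-adj (sym eq))))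

    walk-confined : (S : Site → Set) → Decidable S → (Cut : Site → Set) →
      (∀ {p q} → p ~ q → S p → ¬ S q → Cut q) → (∀ i → ¬ Cut (C i)) →
      ∀ {i i′} → Reach H i i′ → S (C i) → S (C i′)
    walk-confined S S? Cut exit uncut walk Si = decidable-stable (S? _) λ ¬Si′ →
      let _ , y , x∼y , Sx , ¬Sy = Reach-exit-edge (S? ∘ C) walk Si ¬Si′
      in uncut y (exit (E⇒~ x∼y) Sx ¬Sy)

    n̂ : V H
    n̂ = proj₁ (Reach-first-edge (conn s t) s≢t)

    s∼n̂ : E H s n̂
    s∼n̂ = proj₂ (Reach-first-edge (conn s t) s≢t)

    v : V H
    v = proj₁ (C s)

    k : Fin M
    k = proj₂ (C s)

    d-choice : Σ[ j ∈ Fin M ] (toℕ k ∼ toℕ j × j ≢ proj₂ (C n̂))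
    d-choice = neighbour-avoiding k (proj₂ (C n̂))

    j : Fin M
    j = proj₁ d-choice

    k∼j : toℕ k ∼ toℕ j
    k∼j = proj₁ (proj₂ d-choice)

    d : Site
    d = v , j

    s~d : C s ~ d
    s~d = inj₂ (refl , k∼j)

    d-unoccupied : ∀ i → C i ≢ d
    d-unoccupied i Ci≡d = proj₂ (proj₂ d-choice) (cong proj₂ (trans (sym Ci≡d) (cong C i≡n̂)))
      where
      i≡n̂ : i ≡ n̂
      i≡n̂ = s-one (E-sym H (~⇒E (subst (_~ C s) (sym Ci≡d) (~-sym s~d)))) s∼n̂

    -- Leaving the non-hub part of cycle v means entering d, which is unoccupied.
    hub-case : ∀ {m} → proj₂ (C m) ≡ F.zero → j ≡ F.zero → ⊥
    hub-case {m} m-hub j≡0 = proj₂ (walk-confined S S? (_≡ d) exit d-unoccupied (conn s m) (refl , k≢0)) m-hub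
      where
      S : Site → Set
      S (u , x) = u ≡ v × x ≢ F.zero

      S? : Decidable S
      S? (u , x) = (u FP.≟ v) ×-dec ¬? (x FP.≟ F.zero)

      k≢0 : k ≢ F.zero
      k≢0 k≡0 = ∼-irrefl (subst₂ (λ a b → toℕ a ∼ toℕ b) k≡0 j≡0 k∼j)

      exit : ∀ {p q} → p ~ q → S p → ¬ S q → q ≡ d
      exit (inj₁ (x≡0 , _)) (_ , x≢0) _ = ⊥-elim (x≢0 x≡0)
      exit (inj₂ (refl , _)) (refl , _) ¬Sq =
        cong (v ,_) (trans (decidable-stable (_ FP.≟ F.zero) (¬Sq ∘ (refl ,_))) (sym j≡0))

    -- A second copy vertex beside d on cycle v forces every position of the cycle except j to be occupied
    -- (an unoccupied one would, together with j, cut the walk between s and m), i.e. n + 2 positions.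
    cycle-case : ∀ {m} → proj₁ (C m) ≡ v → toℕ (proj₂ (C m)) ∼ toℕ j → C m ≢ C s → ⊥
    cycle-case {m} m-on-v k′∼j Cm≢Cs = cannot-cover (ℕP.<-trans (ℕP.n<1+n _) (ℕP.n<1+n _)) j (proj₂ ∘ C) occupied
      where
      k′ : Fin M
      k′ = proj₂ (C m)

      k≢k′ : k ≢ k′
      k≢k′ k≡k′ = Cm≢Cs (cong₂ _,_ m-on-v (sym k≡k′))

      unoccupied-separates : ∀ {p} → p ≢ j → p ≢ k → p ≢ k′ → (∀ i → C i ≢ (v , p)) → ⊥
      unoccupied-separates {p} p≢j p≢k p≢k′ p-free
        with arc-separating-neighbours (FP.toℕ<n j) (FP.toℕ<n p) (FP.toℕ<n k) (FP.toℕ<n k′)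
               (p≢j ∘ FP.toℕ-injective) (p≢k ∘ FP.toℕ-injective) (p≢k′ ∘ FP.toℕ-injective)
               (k≢k′ ∘ FP.toℕ-injective) k∼j k′∼j
      ... | A , A? , ¬A0 , arc-exit , separates = opposite-sides separates
        where
        S : Site → Set
        S (u , x) = u ≡ v × A (toℕ x)

        S? : Decidable S
        S? (u , x) = (u FP.≟ v) ×-dec A? (toℕ x)

        Cut : Site → Set
        Cut q = q ≡ d ⊎ q ≡ (v , p)

        exit : ∀ {q q′} → q ~ q′ → S q → ¬ S q′ → Cut q′
        exit (inj₁ (x≡0 , _)) (_ , Ax) _ = ⊥-elim (¬A0 (subst (A ∘ toℕ) x≡0 Ax))
        exit (inj₂ (refl , x∼y)) (refl , Ax) ¬Sy =
          Sum.map (cong (v ,_) ∘ FP.toℕ-injective) (cong (v ,_) ∘ FP.toℕ-injective)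
                  (arc-exit x∼y Ax (¬Sy ∘ (refl ,_)))

        uncut : ∀ i → ¬ Cut (C i)
        uncut i = [ d-unoccupied i , p-free i ]′

        opposite-sides : Separates A (toℕ k) (toℕ k′) → ⊥
        opposite-sides (inj₁ (Ak , ¬Ak′)) = ¬Ak′ (proj₂ (walk-confined S S? Cut exit uncut (conn s m) (refl , Ak)))
        opposite-sides (inj₂ (¬Ak , Ak′)) = ¬Ak (proj₂ (walk-confined S S? Cut exit uncut (conn m s) (m-on-v , Ak′)))

      occupied : ∀ p → p ≢ j → ∃[ i ] proj₂ (C i) ≡ p
      occupied p p≢j with p FP.≟ k | p FP.≟ k′ | FP.any? (λ i → C i ≟ˢ (v , p))
      ... | yes refl | _        | _              = s , refl
      ... | no _     | yes refl | _              = m , refl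
      ... | no _     | no _     | yes (i , Ci≡p) = i , cong proj₂ Ci≡p
      ... | no p≢k   | no p≢k′  | no p-free      =
        ⊥-elim (unoccupied-separates p≢j p≢k p≢k′ λ i Ci≡p → p-free (i , Ci≡p))

    beside-d⇒s : ∀ {i} → C i ~ d → i ≡ s
    beside-d⇒s (inj₁ (i-hub , j≡0 , _)) = ⊥-elim (hub-case i-hub j≡0)
    beside-d⇒s {i} (inj₂ (i-on-v , x∼j)) =
      same-site⇒≡ s-twinless (decidable-stable (C i ≟ˢ C s) (cycle-case i-on-v x∼j))

    s′ t′ : V double
    s′ = vertexAt d
    t′ = twin (map f ℓ)

    s′-private : ∀ i → E double (map f i) s′ → map f i ≡ map f s
    s′-private i e = cong (map f) (beside-d⇒s (subst (C i ~_) (siteOf-vertexAt d) (from-does (C i ~? siteOf s′) e)))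

    t′-private : ∀ i → E double (map f i) t′ → map f i ≡ map f t
    t′-private i e = cong (map f) (ℓ-one (E-sym H i∼ℓ) (E-sym H t∼ℓ))
      where
      i∼ℓ : E H i ℓ
      i∼ℓ = trans (sym (preserve f i ℓ)) (trans (sym (adj-twin (map f i) (map f ℓ))) e)

    fs∼s′ : E double (map f s) s′
    fs∼s′ = dec-true (C s ~? siteOf s′) (subst (C s ~_) (sym (siteOf-vertexAt d)) s~d)

    ft∼t′ : E double (map f t) t′
    ft∼t′ = trans (adj-twin (map f t) (map f ℓ)) (trans (preserve f t ℓ) t∼ℓ)

    s′≢t′ : s′ ≢ t′
    s′≢t′ s′≡t′ = s≢t (sym (minj f (s′-private t (subst (E double (map f t)) (sym s′≡t′) ft∼t′))))

    s′≁t′ : ¬ E double s′ t′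
    s′≁t′ e = ℓ≢s (minj f (s′-private ℓ (E-sym double (trans (sym (adj-twin s′ (map f ℓ))) e))))

    s′-fresh : ¬ InImage f s′
    s′-fresh (i , fi≡s′) = d-unoccupied i (trans (cong siteOf fi≡s′) (siteOf-vertexAt d))

    t′-fresh : ¬ InImage f t′
    t′-fresh (i , fi≡t′) with same-site⇒≡ ℓ-twinless (trans (cong siteOf fi≡t′) (cong site (class-twin (map f ℓ))))
    ... | refl = twin-≢ (map f ℓ) (sym fi≡t′)

    extension : IsExtension f (map f s) (map f t) s′ t′
    extension = s′≢t′ , s′-fresh , t′-fresh , fs∼s′ , s′-private , s′≁t′ , ft∼t′ , t′-private

    ¬avoidable : ¬ AvoidableCopy f s t
    ¬avoidable avoidable = covered-end⇒¬Closable f s′≢t′ s′≁t′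
      (λ x x∼t′ → inj₂ (ℓ , E-sym double (trans (sym (adj-twin x (map f ℓ))) x∼t′)))
      (avoidable s′ t′ extension)

lemma4p1 : (Ĥ : Graph) (ŝ t̂ : V Ĥ) → SubcubicTwoRootedTree Ĥ ŝ t̂ →
    ŝ ≢ t̂ → (∃[ ℓ ] (Leaf Ĥ ℓ × ℓ ≢ ŝ × E Ĥ t̂ ℓ)) →
    ¬ (∃[ u ] FalseTwins Ĥ ŝ u) →
    NonInherent Ĥ ŝ t̂
lemma4p1 H s t tree s≢t (ℓ , ℓ-leaf , ℓ≢s , t∼ℓ) s-twinless inherent =
  let f , avoidable = inherent double copy
  in ¬avoidable connected s≢t s-atMostOneNeighbour s-twinless ℓ-one t∼ℓ ℓ≢s ℓ-twinless f avoidable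
  where
  open Obstruction H
  open SubcubicTwoRootedTree-properties tree

  ℓ-one : AtMostOneNeighbour H ℓ
  ℓ-one = deg≡1⇒atMostOneNeighbour H ℓ-leaf

  ℓ-twinless : NoFalseTwin H ℓ
  ℓ-twinless = leaf-noFalseTwin connected t-¬threeNeighbours ℓ-one t∼ℓ s≢t ℓ≢s s-twinless
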